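{- For integers $i \ge 0$ and $j$, let $f(i,j)$ denote the number of permutations of $\{0,1,\dots,i-1\}$ having exactly $j$ type 2 adjacencies (with $f(i,j)=0$ whenever $j<0$ or $j>i$). Then for every $i\ge 3$ and every $0\le j\le i+1$, $$\begin{aligned} f(i,j) ={}& 2\big(f(i-1,j-1)-f(i-2,j-2)\big) + f(i-2,j-2) \\ &+ (j+1)\big(f(i-1,j+1)-f(i-2,j)\big) + (i-j-1)\, f(i-2,j) \\ &+ (i-j-2)\big(f(i-1,j)-f(i-2,j-1)\big) + (j+1)\, f(i-2,j+1).\end{aligned}$$
   Context: A permutation of $\{0,1,\dots,n-1\}$ is written as a sequence $\pi=(\pi_1,\dots,\pi_n)$ in which each symbol occurs exactly once. The type 2 adjacencies (back-adjacencies) of $\pi$ are: each index $i\in\{1,\dots,n-1\}$ with $\pi_{i+1}=\pi_i+1$, and in addition one more adjacency if $\pi_n=n-1$ (thought of as $\pi_n$ being adjacent to an imagined $\pi_{n+1}=n$). Thus a permutation of $\{0,\dots,n-1\}$ has between $0$ and $n$ type 2 adjacencies. -}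

module Defs where

open import Data.Nat using (ℕ; zero; suc; _+_; _∸_; _≟_; _<?_)
open import Data.Integer as ℤ using (ℤ; +_; -[1+_])
open import Data.List using (List; []; _∷_; map; concatMap; length; filter; upTo)
open import Data.List.Relation.Unary.Unique.Propositional using (Unique)
import Data.List.Relation.Unary.Unique.DecPropositional as UD
open import Relation.Nullary.Decidable using (yes; no; does)
open import Data.Bool using (if_then_else_)

seqs : ℕ → ℕ → List (List ℕ)
seqs n zero    = [] ∷ []
seqs n (suc k) = concatMap (λ x → map (x ∷_) (seqs n k)) (upTo n)

-- permutations of {0,…,n-1}: length-n sequences over {0,…,n-1} in which
-- no symbol repeats (hence each symbol occurs exactly once)
perms : ℕ → List (List ℕ)
perms n = filter (UD.unique? _≟_) (seqs n n)

-- number of type 2 adjacencies of a sequence, where `top` is the imagined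
-- value following the last entry (top = n for permutations of {0,…,n-1})
adj2 : ℕ → List ℕ → ℕ
adj2 top []           = 0
adj2 top (x ∷ [])     = if does (suc x ≟ top) then 1 else 0
adj2 top (x ∷ y ∷ xs) = (if does (suc x ≟ y) then 1 else 0) + adj2 top (y ∷ xs)

countPerms : ℕ → ℕ → ℕ
countPerms i j = length (filter (λ p → adj2 i p ≟ j) (perms i))

-- f on integer arguments; zero for negative i or negative j
-- (j > i automatically gives 0 since no permutation has more than i adjacencies)
f : ℤ → ℤ → ℤ
f (+ i) (+ j) = + countPerms i j
f (+ i) -[1+ _ ] = + 0
f -[1+ _ ] _ = + 0

module Submission where

-- Write c(m, j) for the number of permutations of {0,…,m-1} with j type 2
-- adjacencies.  The theorem is a consequence of the first-order recurrence
--
--   c(m+1, j) = c(m, j-1) + (j+1) c(m, j+1) + (m-j) c(m, j),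
--
-- applied once at size i and twice at size i-1, followed by ring algebra.
--
-- The recurrence comes from building every permutation of {0,…,m} from one of
-- {0,…,m-1} by raising all entries by one and inserting the new symbol 0 at
-- one of the m+1 positions.  If the raised permutation has k adjacencies then
-- exactly one insertion point (just before the entry 1) creates an adjacency,
-- exactly k insertion points (inside an adjacency x, x+1) destroy one, and the
-- remaining m-k leave the count unchanged.

open import Defs
open import Data.Nat using (ℕ; _≤_)
open import Relation.Binary.PropositionalEquality

module Counting where

  open import Data.Bool using (true; false; if_then_else_)
  open import Data.Empty using (⊥-elim)
  open import Data.Product using (∃; ∃₂; _×_; _,_)
  open import Data.Nat using (zero; suc; pred; _+_; _*_; _∸_; _<_; z≤n; s≤s; z<s; _≟_; _≤?_; _≡ᵇ_)
  import Data.Nat.Properties as ℕP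
  import Data.Nat.Tactic.RingSolver as ℕRing
  open import Data.List using (List; []; _∷_; _++_; map; length; concatMap; upTo; filter)
  import Data.List.Properties as ListP
  open import Data.List.Relation.Unary.All as All using (All; []; _∷_)
  import Data.List.Relation.Unary.All.Properties as AllP
  open import Data.List.Relation.Unary.Any using (here; there)
  open import Data.List.Relation.Unary.AllPairs using ([]; _∷_)
  open import Data.List.Relation.Binary.Pointwise using (Pointwise; []; _∷_)
  open import Data.List.Relation.Unary.Unique.Propositional using (Unique)
  import Data.List.Relation.Unary.Unique.Propositional.Properties as UniqueP
  import Data.List.Relation.Unary.Unique.DecPropositional as UniqueD
  open import Data.List.Membership.Propositional using (_∈_; find; lose)
  open import Data.List.Membership.Propositional.Properties
    using (∈-map⁺; map∷⁻; ∈-upTo⁺; ∈-upTo⁻; ∈-concatMap⁺; ∈-concatMap⁻; ∈-filter⁺; ∈-filter⁻; ∈-∃++)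
  open import Data.List.Membership.Propositional.Properties.WithK using (unique∧set⇒bag)
  open import Data.List.Membership.DecPropositional _≟_ using (_∈?_)
  open import Data.List.Relation.Binary.Permutation.Propositional using (_↭_; ↭-sym; ↭⇒↭ₛ)
  open import Data.List.Relation.Binary.Permutation.Propositional.Properties
    using (All-resp-↭; ↭-length; shift; filter-↭)
  import Data.List.Relation.Binary.Permutation.Setoid.Properties as PermutationₛP
  open import Data.List.Relation.Binary.BagAndSetEquality using (∼bag⇒↭)
  open import Function.Bundles using (mk⇔)
  open import Relation.Nullary using (¬_; yes; no; does)
  open import Relation.Nullary.Decidable using (dec-false)

  ind : ℕ → ℕ → ℕ
  ind a b = if does (a ≟ b) then 1 else 0

  ind-≢ : ∀ {a b} → a ≢ b → ind a b ≡ 0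
  ind-≢ {a} {b} a≢b = cong (if_then 1 else 0) (dec-false (a ≟ b) a≢b)

  ind-transfer : ∀ (g : ℕ → ℕ) a b → g a * ind a b ≡ g b * ind a b
  ind-transfer g a b with a ≟ b
  ... | yes refl = refl
  ... | no a≢b rewrite ind-≢ a≢b = trans (ℕP.*-zeroʳ (g a)) (sym (ℕP.*-zeroʳ (g b)))

  -- The weight k · [k - 1 = j] of the losses from a list with k adjacencies,
  -- rewritten as (j + 1) · [k = j + 1]; the two agree also for k = 0.
  pred-weight : ∀ k j → k * ind (pred k) j ≡ suc j * ind k (suc j)
  pred-weight zero    j = sym (ℕP.*-zeroʳ (suc j))
  pred-weight (suc k) j = ind-transfer suc k j

  total : ∀ {A : Set} → (A → ℕ) → List A → ℕ
  total f []       = 0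
  total f (x ∷ xs) = f x + total f xs

  total-++ : ∀ {A : Set} (f : A → ℕ) xs ys → total f (xs ++ ys) ≡ total f xs + total f ys
  total-++ f []       ys = refl
  total-++ f (x ∷ xs) ys = trans (cong (f x +_) (total-++ f xs ys)) (sym (ℕP.+-assoc (f x) _ _))

  total-concatMap : ∀ {A B : Set} (f : B → ℕ) (g : A → List B) xs →
                    total f (concatMap g xs) ≡ total (λ x → total f (g x)) xs
  total-concatMap f g []       = refl
  total-concatMap f g (x ∷ xs) =
    trans (total-++ f (g x) (concatMap g xs)) (cong (total f (g x) +_) (total-concatMap f g xs))

  total-cong : ∀ {A : Set} {f g : A → ℕ} xs → (∀ {x} → x ∈ xs → f x ≡ g x) → total f xs ≡ total g xs
  total-cong []       f≡g = refl
  total-cong (x ∷ xs) f≡g = cong₂ _+_ (f≡g (here refl)) (total-cong xs (λ x∈ → f≡g (there x∈)))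

  total-+ : ∀ {A : Set} (f g : A → ℕ) xs → total (λ x → f x + g x) xs ≡ total f xs + total g xs
  total-+ f g []       = refl
  total-+ f g (x ∷ xs) = trans (cong (f x + g x +_) (total-+ f g xs)) (interchange (f x) (g x) _ _)
    where
    interchange : ∀ a b c d → a + b + (c + d) ≡ a + c + (b + d)
    interchange = ℕRing.solve-∀

  total-* : ∀ {A : Set} c (f : A → ℕ) xs → total (λ x → c * f x) xs ≡ c * total f xs
  total-* c f []       = sym (ℕP.*-zeroʳ c)
  total-* c f (x ∷ xs) = trans (cong (c * f x +_) (total-* c f xs)) (sym (ℕP.*-distribˡ-+ c (f x) _))

  total-zero : ∀ {A : Set} (xs : List A) → total (λ _ → 0) xs ≡ 0
  total-zero []       = refl
  total-zero (x ∷ xs) = total-zero xs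

  next : ℕ → List ℕ → ℕ
  next top []      = top
  next top (y ∷ _) = y

  adj2-∷ : ∀ top x L → adj2 top (x ∷ L) ≡ ind (suc x) (next top L) + adj2 top L
  adj2-∷ top x []      = sym (ℕP.+-identityʳ _)
  adj2-∷ top x (y ∷ L) = refl

  -- Every entry carries at most one adjacency.
  adj2≤length : ∀ top L → adj2 top L ≤ length L
  adj2≤length top []      = z≤n
  adj2≤length top (x ∷ L) =
    ℕP.≤-trans (ℕP.≤-reflexive (adj2-∷ top x L)) (ℕP.+-mono-≤ (ind≤1 (suc x) (next top L)) (adj2≤length top L))
    where
    ind≤1 : ∀ a b → ind a b ≤ 1
    ind≤1 a b with does (a ≟ b)
    ... | true  = s≤s z≤n
    ... | false = z≤n

  adj2-suc : ∀ top σ → adj2 (suc top) (map suc σ) ≡ adj2 top σ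
  adj2-suc top []          = refl
  adj2-suc top (x ∷ [])    = refl
  adj2-suc top (x ∷ y ∷ σ) = cong (ind (suc x) y +_) (adj2-suc top (y ∷ σ))

  hits : ℕ → ℕ → List ℕ → ℕ
  hits a top []      = ind a top
  hits a top (y ∷ L) = ind a y + hits a top L

  hits-mid : ∀ a top α x β → hits a top (α ++ x ∷ β) ≡ ind a x + hits a top (α ++ β)
  hits-mid a top []      x β = refl
  hits-mid a top (y ∷ α) x β =
    trans (cong (ind a y +_) (hits-mid a top α x β)) (left-swap (ind a y) (ind a x) _)
    where
    left-swap : ∀ p q r → p + (q + r) ≡ q + (p + r)
    left-swap = ℕRing.solve-∀

  hits-suc : ∀ a top σ → hits (suc a) (suc top) (map suc σ) ≡ hits a top σ
  hits-suc a top []      = refl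
  hits-suc a top (y ∷ σ) = cong (ind a y +_) (hits-suc a top σ)

  hits-zero-suc : ∀ top σ → hits 0 (suc top) (map suc σ) ≡ 0
  hits-zero-suc top []      = refl
  hits-zero-suc top (y ∷ σ) = hits-zero-suc top σ

  all-suc : ∀ σ → All (1 ≤_) (map suc σ)
  all-suc σ = AllP.map⁺ (All.universal (λ _ → s≤s z≤n) σ)

  insert0⁺ : List ℕ → List (List ℕ)
  insert0 : List ℕ → List (List ℕ)
  insert0⁺ []      = []
  insert0⁺ (x ∷ S) = map (x ∷_) (insert0 S)
  insert0 S = (0 ∷ S) ∷ insert0⁺ S

  insert0⁺-next : ∀ top S → All (λ w → next top w ≡ next top S) (insert0⁺ S)
  insert0⁺-next top []      = []
  insert0⁺-next top (x ∷ S) = AllP.map⁺ (All.universal (λ _ → refl) (insert0 S))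

  data Change : Set where
    gain loss keep : Change

  Step : ℕ → Change → ℕ → Set
  Step k gain v = v ≡ suc k
  Step k loss v = suc v ≡ k
  Step k keep v = v ≡ k

  step-shift : ∀ a {k} c {v} → Step k c v → Step (a + k) c (a + v)
  step-shift a gain v≡1+k = trans (cong (a +_) v≡1+k) (ℕP.+-suc a _)
  step-shift a loss 1+v≡k = trans (sym (ℕP.+-suc a _)) (cong (a +_) 1+v≡k)
  step-shift a keep v≡k   = cong (a +_) v≡k

  front : ℕ → Change
  front y = if does (1 ≟ y) then gain else keep

  between : ℕ → ℕ → Change
  between x y = if does (1 ≟ y) then gain else (if does (suc x ≟ y) then loss else keep)

  front-step : ∀ y a → Step a (front y) (ind 1 y + a)
  front-step zero          a = refl
  front-step (suc zero)    a = refl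
  front-step (suc (suc y)) a = refl

  between-step : ∀ x y a → 1 ≤ x → Step (ind (suc x) y + a) (between x y) (ind 1 y + a)
  between-step x        zero          a _ = refl
  between-step (suc x)  (suc zero)    a _ = refl
  between-step x        (suc (suc y)) a _ with x ≡ᵇ suc y
  ... | true  = refl
  ... | false = refl

  changes⁺ : ℕ → List ℕ → List Change
  changes⁺ top []      = []
  changes⁺ top (x ∷ S) = between x (next top S) ∷ changes⁺ top S

  changes : ℕ → List ℕ → List Change
  changes top S = front (next top S) ∷ changes⁺ top S

  Changes : ℕ → ℕ → List Change → List (List ℕ) → Set
  Changes top k = Pointwise (λ c w → Step k c (adj2 top w))

  changes-prefix : ∀ top x h {k cs ws} → Changes top k cs ws → All (λ w → next top w ≡ h) ws →
                   Changes top (ind (suc x) h + k) cs (map (x ∷_) ws)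
  changes-prefix top x h []                         []              = []
  changes-prefix top x h (_∷_ {c} {w} step steps) (next≡h ∷ nexts) =
    subst (Step _ c) (sym (trans (adj2-∷ top x w) (cong (λ y → ind (suc x) y + adj2 top w) next≡h)))
          (step-shift (ind (suc x) h) c step)
    ∷ changes-prefix top x h steps nexts

  changes⁺-correct : ∀ top S → All (1 ≤_) S → Changes top (adj2 top S) (changes⁺ top S) (insert0⁺ S)
  changes⁺-correct top []      _            = []
  changes⁺-correct top (x ∷ S) (1≤x ∷ 1≤S) =
    subst (λ k → Changes top k (changes⁺ top (x ∷ S)) (insert0⁺ (x ∷ S))) (sym (adj2-∷ top x S))
      (subst (Step _ _) (sym (adj2-∷ top 0 S)) (between-step x (next top S) (adj2 top S) 1≤x)
       ∷ changes-prefix top x (next top S) (changes⁺-correct top S 1≤S) (insert0⁺-next top S))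

  changes-correct : ∀ top S → All (1 ≤_) S → Changes top (adj2 top S) (changes top S) (insert0 S)
  changes-correct top S 1≤S =
    subst (Step _ _) (sym (adj2-∷ top 0 S)) (front-step (next top S) (adj2 top S))
    ∷ changes⁺-correct top S 1≤S

  isGain isLoss isKeep : Change → ℕ
  isGain gain = 1
  isGain _    = 0
  isLoss loss = 1
  isLoss _    = 0
  isKeep keep = 1
  isKeep _    = 0

  count : ℕ → ℕ → List (List ℕ) → ℕ
  count top j = total (λ w → ind (adj2 top w) j)

  count-by-changes : ∀ top j {k cs ws} → Changes top k cs ws →
    count top j ws ≡ total isGain cs * ind (suc k) j + total isLoss cs * ind (pred k) j
                     + total isKeep cs * ind k j
  count-by-changes top j [] = refl
  count-by-changes top j {k} (_∷_ {x = gain} {xs = cs} v≡1+k steps) =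
    trans (cong₂ _+_ (cong (λ v → ind v j) v≡1+k) (count-by-changes top j steps))
          (add-gain (ind (suc k) j) (ind (pred k) j) (ind k j) (total isGain cs) (total isLoss cs) (total isKeep cs))
    where
    add-gain : ∀ A B C g l n → A + (g * A + l * B + n * C) ≡ (1 + g) * A + l * B + n * C
    add-gain = ℕRing.solve-∀
  count-by-changes top j {k} (_∷_ {x = loss} {xs = cs} 1+v≡k steps) =
    trans (cong₂ _+_ (cong (λ v → ind v j) (cong pred 1+v≡k)) (count-by-changes top j steps))
          (add-loss (ind (suc k) j) (ind (pred k) j) (ind k j) (total isGain cs) (total isLoss cs) (total isKeep cs))
    where
    add-loss : ∀ A B C g l n → B + (g * A + l * B + n * C) ≡ g * A + (1 + l) * B + n * C
    add-loss = ℕRing.solve-∀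
  count-by-changes top j {k} (_∷_ {x = keep} {xs = cs} v≡k steps) =
    trans (cong₂ _+_ (cong (λ v → ind v j) v≡k) (count-by-changes top j steps))
          (add-keep (ind (suc k) j) (ind (pred k) j) (ind k j) (total isGain cs) (total isLoss cs) (total isKeep cs))
    where
    add-keep : ∀ A B C g l n → C + (g * A + l * B + n * C) ≡ g * A + l * B + (1 + n) * C
    add-keep = ℕRing.solve-∀

  total-kinds : ∀ cs → total isGain cs + total isLoss cs + total isKeep cs ≡ length cs
  total-kinds []          = refl
  total-kinds (gain ∷ cs) = cong suc (total-kinds cs)
  total-kinds (loss ∷ cs) =
    trans (add-one (total isGain cs) (total isLoss cs) (total isKeep cs)) (cong suc (total-kinds cs))
    where
    add-one : ∀ g l n → g + suc l + n ≡ suc (g + l + n)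
    add-one = ℕRing.solve-∀
  total-kinds (keep ∷ cs) =
    trans (add-one (total isGain cs) (total isLoss cs) (total isKeep cs)) (cong suc (total-kinds cs))
    where
    add-one : ∀ g l n → g + l + suc n ≡ suc (g + l + n)
    add-one = ℕRing.solve-∀

  length-changes : ∀ top S → length (changes top S) ≡ suc (length S)
  length-changes top []      = refl
  length-changes top (x ∷ S) = cong suc (length-changes top S)

  gains : ∀ top S → total isGain (changes top S) ≡ hits 1 top S
  gains top S = trans (cong (_+ total isGain (changes⁺ top S)) (isGain-front (next top S))) (gains⁺ S)
    where
    isGain-front : ∀ y → isGain (front y) ≡ ind 1 y
    isGain-front zero          = refl
    isGain-front (suc zero)    = refl
    isGain-front (suc (suc y)) = refl
    isGain-between : ∀ x y → isGain (between x y) ≡ ind 1 y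
    isGain-between x zero          = refl
    isGain-between x (suc zero)    = refl
    isGain-between x (suc (suc y)) with x ≡ᵇ suc y
    ... | true  = refl
    ... | false = refl
    gains⁺ : ∀ S → ind 1 (next top S) + total isGain (changes⁺ top S) ≡ hits 1 top S
    gains⁺ []      = ℕP.+-identityʳ _
    gains⁺ (x ∷ S) =
      cong (ind 1 x +_)
           (trans (cong (_+ total isGain (changes⁺ top S)) (isGain-between x (next top S))) (gains⁺ S))

  losses : ∀ top S → All (1 ≤_) S → total isLoss (changes top S) ≡ adj2 top S
  losses top S 1≤S =
    trans (cong (_+ total isLoss (changes⁺ top S)) (isLoss-front (next top S))) (losses⁺ S 1≤S)
    where
    isLoss-front : ∀ y → isLoss (front y) ≡ 0
    isLoss-front zero          = refl
    isLoss-front (suc zero)    = refl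
    isLoss-front (suc (suc y)) = refl
    isLoss-between : ∀ x y → 1 ≤ x → isLoss (between x y) ≡ ind (suc x) y
    isLoss-between x        zero          _ = refl
    isLoss-between (suc x)  (suc zero)    _ = refl
    isLoss-between x        (suc (suc y)) _ with x ≡ᵇ suc y
    ... | true  = refl
    ... | false = refl
    losses⁺ : ∀ S → All (1 ≤_) S → total isLoss (changes⁺ top S) ≡ adj2 top S
    losses⁺ []      []            = refl
    losses⁺ (x ∷ S) (1≤x ∷ 1≤S) =
      trans (cong₂ _+_ (isLoss-between x (next top S) 1≤x) (losses⁺ S 1≤S)) (sym (adj2-∷ top x S))

  -- With k = adj2 top S,
  -- there is one gain, k losses and length S - k neutral insertions.
  insertion-count : ∀ top j S → All (1 ≤_) S → hits 1 top S ≡ 1 →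
    let k = adj2 top S in
    count top j (insert0 S) ≡ ind (suc k) j + suc j * ind k (suc j) + (length S ∸ j) * ind k j
  insertion-count top j S 1≤S one =
    begin
      count top j (insert0 S)
    ≡⟨ count-by-changes top j (changes-correct top S 1≤S) ⟩
      G * ind (suc k) j + L * ind (pred k) j + N * ind k j
    ≡⟨ cong₂ (λ g l → g * ind (suc k) j + l * ind (pred k) j + N * ind k j) G≡1 L≡k ⟩
      1 * ind (suc k) j + k * ind (pred k) j + N * ind k j
    ≡⟨ cong₂ (λ a b → a + b + N * ind k j) (ℕP.*-identityˡ _) (pred-weight k j) ⟩
      ind (suc k) j + suc j * ind k (suc j) + N * ind k j
    ≡⟨ cong (ind (suc k) j + suc j * ind k (suc j) +_) keeps ⟩
      ind (suc k) j + suc j * ind k (suc j) + (length S ∸ j) * ind k j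
    ∎
    where
    open ≡-Reasoning
    cs = changes top S
    k = adj2 top S
    G = total isGain cs
    L = total isLoss cs
    N = total isKeep cs
    G≡1 : G ≡ 1
    G≡1 = trans (gains top S) one
    L≡k : L ≡ k
    L≡k = losses top S 1≤S
    k+N≡length : k + N ≡ length S
    k+N≡length = cong pred (begin
      1 + k + N ≡⟨ cong₂ (λ g l → g + l + N) (sym G≡1) (sym L≡k) ⟩
      G + L + N ≡⟨ total-kinds cs ⟩
      length cs ≡⟨ length-changes top S ⟩
      suc (length S) ∎)
    keeps : N * ind k j ≡ (length S ∸ j) * ind k j
    keeps = begin
      N * ind k j              ≡⟨ cong (_* ind k j) (sym (ℕP.m+n∸m≡n k N)) ⟩
      (k + N ∸ k) * ind k j    ≡⟨ cong (λ n → (n ∸ k) * ind k j) k+N≡length ⟩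
      (length S ∸ k) * ind k j ≡⟨ ind-transfer (length S ∸_) k j ⟩
      (length S ∸ j) * ind k j ∎

  Unique-resp-↭ : ∀ {xs ys : List ℕ} → xs ↭ ys → Unique xs → Unique ys
  Unique-resp-↭ xs↭ys = PermutationₛP.Unique-resp-↭ (setoid ℕ) (↭⇒↭ₛ xs↭ys)

  avoid : ∀ {n ys} → All (_< suc n) ys → All (n ≢_) ys → All (_< n) ys
  avoid b n∉ = All.zipWith (λ (y<1+n , n≢y) → ℕP.≤∧≢⇒< (ℕP.≤-pred y<1+n) (λ y≡n → n≢y (sym y≡n))) (b , n∉)

  pigeonhole : ∀ n xs → Unique xs → All (_< n) xs → length xs ≤ n
  pigeonhole zero    []      _ _        = z≤n
  pigeonhole zero    (_ ∷ _) _ (() ∷ _)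
  pigeonhole (suc n) xs      u bounded with n ∈? xs
  ... | no n∉xs = ℕP.m≤n⇒m≤1+n (pigeonhole n xs u (avoid bounded (AllP.¬Any⇒All¬ xs n∉xs)))
  ... | yes n∈xs with α , β , refl ← ∈-∃++ n∈xs
                 with n∉αβ ∷ uαβ ← Unique-resp-↭ (shift n α β) u
                    | _ ∷ bαβ ← All-resp-↭ (shift n α β) bounded =
    ℕP.≤-trans (ℕP.≤-reflexive (↭-length (shift n α β))) (s≤s (pigeonhole n (α ++ β) uαβ (avoid bαβ n∉αβ)))

  record IsPerm (m : ℕ) (π : List ℕ) : Set where
    constructor isPerm
    field
      length≡  : length π ≡ m
      bounded  : All (_< m) π
      distinct : Unique π

  IsPerm-resp-↭ : ∀ {m π π′} → π ↭ π′ → IsPerm m π → IsPerm m π′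
  IsPerm-resp-↭ π↭π′ (isPerm len bnd u) =
    isPerm (trans (sym (↭-length π↭π′)) len) (All-resp-↭ π↭π′ bnd) (Unique-resp-↭ π↭π′ u)

  raise-lower : ∀ {L} → All (0 ≢_) L → map suc (map pred L) ≡ L
  raise-lower []                  = refl
  raise-lower {zero ∷ _} (0≢0 ∷ _) = ⊥-elim (0≢0 refl)
  raise-lower {suc x ∷ _} (_ ∷ nz) = cong (suc x ∷_) (raise-lower nz)

  lower : ∀ {n L} → All (0 ≢_) L → All (_< suc n) L → Unique L →
          All (_< n) (map pred L) × Unique (map pred L)
  lower {L = L} nz bnd u =
      All.map ℕP.≤-pred (AllP.map⁻ (subst (All (_< _)) (sym (raise-lower nz)) bnd))
    , UniqueP.map⁻ (subst Unique (sym (raise-lower nz)) u)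

  raise-cons0 : ∀ {m τ} → IsPerm m τ → IsPerm (suc m) (0 ∷ map suc τ)
  raise-cons0 {τ = τ} (isPerm len bnd u) =
    isPerm (cong suc (trans (ListP.length-map suc τ) len))
           (z<s ∷ AllP.map⁺ (All.map s≤s bnd))
           (AllP.map⁺ (All.universal (λ _ ()) τ) ∷ UniqueP.map⁺ ℕP.suc-injective u)

  -- Every permutation of {0,…,m} contains 0, by the pigeonhole principle.
  zero-mem : ∀ {m π} → IsPerm (suc m) π → 0 ∈ π
  zero-mem {m} {π} (isPerm len bnd u) with 0 ∈? π
  ... | yes 0∈π = 0∈π
  ... | no 0∉π with lower-bnd , lower-u ← lower (AllP.¬Any⇒All¬ π 0∉π) bnd u =
    ⊥-elim (ℕP.<-irrefl refl (ℕP.≤-trans (ℕP.≤-reflexive (sym length-lowered)) (pigeonhole m _ lower-u lower-bnd)))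
    where
    length-lowered : length (map pred π) ≡ suc m
    length-lowered = trans (ListP.length-map pred π) len

  concatMap-unique : ∀ {A B : Set} (g : A → List B) (h : B → A) {xs} → Unique xs →
    (∀ x → Unique (g x)) → (∀ {x w} → w ∈ g x → h w ≡ x) → Unique (concatMap g xs)
  concatMap-unique g h {[]}     _          _  _   = []
  concatMap-unique g h {x ∷ xs} (x∉xs ∷ u) ug inv =
    UniqueP.++⁺ (ug x) (concatMap-unique g h u ug inv) disjoint
    where
    disjoint : ∀ {w} → ¬ (w ∈ g x × w ∈ concatMap g xs)
    disjoint (w∈gx , w∈rest) with y , y∈xs , w∈gy ← find (∈-concatMap⁻ g w∈rest) =
      All.lookup x∉xs y∈xs (trans (sym (inv w∈gx)) (inv w∈gy))

  seqs-mem⁻ : ∀ n k {π} → π ∈ seqs n k → length π ≡ k × All (_< n) π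
  seqs-mem⁻ n zero    (here refl) = refl , []
  seqs-mem⁻ n (suc k) π∈
    with x , x∈ , π∈′ ← find (∈-concatMap⁻ (λ x → map (x ∷_) (seqs n k)) {xs = upTo n} π∈)
    with π′ , π′∈ , refl ← map∷⁻ π∈′
    with len , bnd ← seqs-mem⁻ n k π′∈ = cong suc len , ∈-upTo⁻ x∈ ∷ bnd

  seqs-mem⁺ : ∀ n k π → length π ≡ k → All (_< n) π → π ∈ seqs n k
  seqs-mem⁺ n zero    []      refl []          = here refl
  seqs-mem⁺ n (suc k) (x ∷ π) len  (x<n ∷ bnd) =
    ∈-concatMap⁺ (λ x → map (x ∷_) (seqs n k)) {xs = upTo n}
      (lose (∈-upTo⁺ x<n) (∈-map⁺ (x ∷_) (seqs-mem⁺ n k π (cong pred len) bnd)))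

  seqs-unique : ∀ n k → Unique (seqs n k)
  seqs-unique n zero    = [] ∷ []
  seqs-unique n (suc k) =
    concatMap-unique (λ x → map (x ∷_) (seqs n k)) (next 0) (UniqueP.upTo⁺ n)
      (λ x → UniqueP.map⁺ ListP.∷-injectiveʳ (seqs-unique n k))
      next-prefix
    where
    next-prefix : ∀ {x w} {L : List (List ℕ)} → w ∈ map (x ∷_) L → next 0 w ≡ x
    next-prefix w∈ with _ , _ , refl ← map∷⁻ w∈ = refl

  perms-mem⁻ : ∀ m {π} → π ∈ perms m → IsPerm m π
  perms-mem⁻ m π∈ with π∈seqs , u ← ∈-filter⁻ (UniqueD.unique? _≟_) π∈
                  with len , bnd ← seqs-mem⁻ m m π∈seqs = isPerm len bnd u

  perms-mem⁺ : ∀ m {π} → IsPerm m π → π ∈ perms m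
  perms-mem⁺ m {π} (isPerm len bnd u) = ∈-filter⁺ (UniqueD.unique? _≟_) (seqs-mem⁺ m m π len bnd) u

  perms-unique : ∀ m → Unique (perms m)
  perms-unique m = UniqueP.filter⁺ (UniqueD.unique? _≟_) (seqs-unique m m)

  insert0-mem⁺ : ∀ α β → α ++ 0 ∷ β ∈ insert0 (α ++ β)
  insert0-mem⁺ []      β = here refl
  insert0-mem⁺ (a ∷ α) β = there (∈-map⁺ (a ∷_) (insert0-mem⁺ α β))

  insert0-mem⁻ : ∀ S {w} → w ∈ insert0 S → ∃₂ λ α β → S ≡ α ++ β × w ≡ α ++ 0 ∷ β
  insert0-mem⁻ S       (here refl) = [] , S , refl , refl
  insert0-mem⁻ (x ∷ S) (there w∈)
    with w′ , w′∈ , refl ← map∷⁻ {xss = insert0 S} w∈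
    with α , β , refl , refl ← insert0-mem⁻ S w′∈ = x ∷ α , β , refl , refl

  insert0-unique : ∀ S → All (1 ≤_) S → Unique (insert0 S)
  insert0-unique []      []            = [] ∷ []
  insert0-unique (x ∷ S) (1≤x ∷ 1≤S) =
    AllP.map⁺ (All.universal (λ w eq → ℕP.<⇒≢ 1≤x (ListP.∷-injectiveˡ eq)) (insert0 S))
    ∷ UniqueP.map⁺ ListP.∷-injectiveʳ (insert0-unique S 1≤S)

  insert0-strip : ∀ S {w} → All (1 ≤_) S → w ∈ insert0 S → filter (1 ≤?_) w ≡ S
  insert0-strip S 1≤S w∈ with α , β , refl , refl ← insert0-mem⁻ S w∈ =
    begin
      filter (1 ≤?_) (α ++ 0 ∷ β)            ≡⟨ ListP.filter-++ (1 ≤?_) α (0 ∷ β) ⟩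
      filter (1 ≤?_) α ++ filter (1 ≤?_) β   ≡⟨ ListP.filter-++ (1 ≤?_) α β ⟨
      filter (1 ≤?_) (α ++ β)                ≡⟨ ListP.filter-all (1 ≤?_) 1≤S ⟩
      α ++ β                                 ∎
    where open ≡-Reasoning

  build : ℕ → List (List ℕ)
  build zero    = [] ∷ []
  build (suc m) = concatMap (λ σ → insert0 (map suc σ)) (build m)

  build-mem⁻ : ∀ m {π} → π ∈ build (suc m) →
    ∃₂ λ τ α → ∃ λ β → τ ∈ build m × map suc τ ≡ α ++ β × π ≡ α ++ 0 ∷ β
  build-mem⁻ m π∈
    with τ , τ∈ , π∈′ ← find (∈-concatMap⁻ (λ σ → insert0 (map suc σ)) {xs = build m} π∈)
    with α , β , e , refl ← insert0-mem⁻ (map suc τ) π∈′ = τ , α , β , τ∈ , e , refl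

  build-sound : ∀ m {π} → π ∈ build m → IsPerm m π
  build-sound zero    (here refl) = isPerm refl [] []
  build-sound (suc m) π∈ with τ , α , β , τ∈ , e , refl ← build-mem⁻ m π∈ =
    IsPerm-resp-↭ (↭-sym (shift 0 α β))
                  (subst (λ L → IsPerm (suc m) (0 ∷ L)) e (raise-cons0 (build-sound m τ∈)))

  build-zero-once : ∀ m {π} → π ∈ build m → hits 0 m π ≡ 1
  build-zero-once zero    (here refl) = refl
  build-zero-once (suc m) π∈ with τ , α , β , τ∈ , e , refl ← build-mem⁻ m π∈ =
    begin
      hits 0 (suc m) (α ++ 0 ∷ β)    ≡⟨ hits-mid 0 (suc m) α 0 β ⟩
      1 + hits 0 (suc m) (α ++ β)    ≡⟨ cong (λ L → 1 + hits 0 (suc m) L) e ⟨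
      1 + hits 0 (suc m) (map suc τ) ≡⟨ cong (1 +_) (hits-zero-suc m τ) ⟩
      1                              ∎
    where open ≡-Reasoning

  build-complete : ∀ m {π} → IsPerm m π → π ∈ build m
  build-complete zero    {[]}    _                = here refl
  build-complete zero    {_ ∷ _} (isPerm () _ _)
  build-complete (suc m) {π}     perm
    with α , β , refl ← ∈-∃++ (zero-mem perm)
    with isPerm len (_ ∷ bnd) (nz ∷ u) ← IsPerm-resp-↭ (shift 0 α β) perm
    with lower-bnd , lower-u ← lower nz bnd u =
    ∈-concatMap⁺ (λ σ → insert0 (map suc σ)) {xs = build m}
      (lose (build-complete m lowered-perm)
            (subst (λ S → α ++ 0 ∷ β ∈ insert0 S) (sym (raise-lower nz)) (insert0-mem⁺ α β)))
    where
    lowered-perm : IsPerm m (map pred (α ++ β))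
    lowered-perm = isPerm (trans (ListP.length-map pred (α ++ β)) (ℕP.suc-injective len)) lower-bnd lower-u

  -- Deleting 0 and lowering recovers the element of build m an insertion came from.
  build-unique : ∀ m → Unique (build m)
  build-unique zero    = [] ∷ []
  build-unique (suc m) =
    concatMap-unique (λ σ → insert0 (map suc σ)) (λ w → map pred (filter (1 ≤?_) w)) (build-unique m)
      (λ τ → insert0-unique (map suc τ) (all-suc τ))
      (λ {τ} w∈ → trans (cong (map pred) (insert0-strip (map suc τ) (all-suc τ) w∈)) (lower-raise τ))
    where
    lower-raise : ∀ τ → map pred (map suc τ) ≡ τ
    lower-raise τ = trans (sym (ListP.map-∘ τ)) (ListP.map-id τ)

  perms↭build : ∀ m → perms m ↭ build m
  perms↭build m = ∼bag⇒↭ (unique∧set⇒bag (perms-unique m) (build-unique m)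
    (mk⇔ (λ π∈ → build-complete m (perms-mem⁻ m π∈)) (λ π∈ → perms-mem⁺ m (build-sound m π∈))))

  previous : (ℕ → ℕ) → ℕ → ℕ
  previous g zero    = 0
  previous g (suc j) = g j

  total-previous : ∀ top j L → total (λ σ → ind (suc (adj2 top σ)) j) L ≡ previous (λ i → count top i L) j
  total-previous top zero    L = total-zero L
  total-previous top (suc j) L = refl

  insertion-count-build : ∀ m j {σ} → σ ∈ build m →
    let k = adj2 m σ in
    count (suc m) j (insert0 (map suc σ)) ≡ ind (suc k) j + suc j * ind k (suc j) + (m ∸ j) * ind k j
  insertion-count-build m j {σ} σ∈ =
    trans (insertion-count (suc m) j (map suc σ) (all-suc σ) (trans (hits-suc 0 m σ) (build-zero-once m σ∈)))
          (cong₂ (λ k n → ind (suc k) j + suc j * ind k (suc j) + (n ∸ j) * ind k j)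
                 (adj2-suc m σ) (trans (ListP.length-map suc σ) (IsPerm.length≡ (build-sound m σ∈))))

  build-recurrence : ∀ m j → count (suc m) j (build (suc m)) ≡
    previous (λ i → count m i (build m)) j + suc j * count m (suc j) (build m) + (m ∸ j) * count m j (build m)
  build-recurrence m j =
    begin
      count (suc m) j (build (suc m))
    ≡⟨ total-concatMap _ (λ σ → insert0 (map suc σ)) (build m) ⟩
      total (λ σ → count (suc m) j (insert0 (map suc σ))) (build m)
    ≡⟨ total-cong (build m) (insertion-count-build m j) ⟩
      total (λ σ → W₁ σ + W₂ σ + W₃ σ) (build m)
    ≡⟨ total-+ (λ σ → W₁ σ + W₂ σ) W₃ (build m) ⟩
      total (λ σ → W₁ σ + W₂ σ) (build m) + total W₃ (build m)
    ≡⟨ cong₂ _+_ (total-+ W₁ W₂ (build m)) (total-* (m ∸ j) (λ σ → ind (A σ) j) (build m)) ⟩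
      total W₁ (build m) + total W₂ (build m) + (m ∸ j) * count m j (build m)
    ≡⟨ cong₂ (λ a b → a + b + (m ∸ j) * count m j (build m))
             (total-previous m j (build m)) (total-* (suc j) (λ σ → ind (A σ) (suc j)) (build m)) ⟩
      previous (λ i → count m i (build m)) j + suc j * count m (suc j) (build m) + (m ∸ j) * count m j (build m)
    ∎
    where
    open ≡-Reasoning
    A : List ℕ → ℕ
    A = adj2 m
    W₁ W₂ W₃ : List ℕ → ℕ
    W₁ σ = ind (suc (A σ)) j
    W₂ σ = suc j * ind (A σ) (suc j)
    W₃ σ = (m ∸ j) * ind (A σ) j

  countPerms≡count : ∀ m j → countPerms m j ≡ count m j (build m)
  countPerms≡count m j =
    trans (↭-length (filter-↭ (λ π → adj2 m π ≟ j) (perms↭build m))) (length-filter (build m))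
    where
    length-filter : ∀ L → length (filter (λ π → adj2 m π ≟ j) L) ≡ count m j L
    length-filter []      = refl
    length-filter (π ∷ L) with adj2 m π ≡ᵇ j
    ... | true  = cong suc (length-filter L)
    ... | false = length-filter L

  countPerms-recurrence : ∀ m j → countPerms (suc m) j ≡
    previous (countPerms m) j + suc j * countPerms m (suc j) + (m ∸ j) * countPerms m j
  countPerms-recurrence m j =
    begin
      countPerms (suc m) j
    ≡⟨ countPerms≡count (suc m) j ⟩
      count (suc m) j (build (suc m))
    ≡⟨ build-recurrence m j ⟩
      previous (λ i → count m i (build m)) j + suc j * count m (suc j) (build m) + (m ∸ j) * count m j (build m)
    ≡⟨ cong₂ (λ p q → p + suc j * q + (m ∸ j) * count m j (build m))
             (previous-count j) (sym (countPerms≡count m (suc j))) ⟩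
      previous (countPerms m) j + suc j * countPerms m (suc j) + (m ∸ j) * count m j (build m)
    ≡⟨ cong (λ r → previous (countPerms m) j + suc j * countPerms m (suc j) + (m ∸ j) * r)
            (sym (countPerms≡count m j)) ⟩
      previous (countPerms m) j + suc j * countPerms m (suc j) + (m ∸ j) * countPerms m j
    ∎
    where
    open ≡-Reasoning
    previous-count : ∀ j → previous (λ i → count m i (build m)) j ≡ previous (countPerms m) j
    previous-count zero    = refl
    previous-count (suc j) = sym (countPerms≡count m j)

  -- A permutation of {0,…,m-1} has at most m adjacencies.
  countPerms-vanishes : ∀ m j → m < j → countPerms m j ≡ 0
  countPerms-vanishes m j m<j =
    cong length (ListP.filter-none (λ π → adj2 m π ≟ j) (All.tabulate too-few))
    where
    too-few : ∀ {π} → π ∈ perms m → adj2 m π ≢ j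
    too-few {π} π∈ = ℕP.<⇒≢ (ℕP.≤-<-trans adj≤m m<j)
      where
      adj≤m : adj2 m π ≤ m
      adj≤m = ℕP.≤-trans (adj2≤length m π) (ℕP.≤-reflexive (IsPerm.length≡ (perms-mem⁻ m π∈)))

open Counting using (previous; countPerms-recurrence; countPerms-vanishes)
open import Data.Integer using (ℤ; +_; -[1+_]; _+_; _-_; _*_)
import Data.Integer.Properties as ℤP
open import Data.Integer.Tactic.RingSolver using (solve-∀)
import Data.Nat as ℕ
import Data.Nat.Properties as ℕP
open import Data.Sum using (inj₁; inj₂)

-- Where countPerms m j is nonzero, j ≤ m and so the truncated difference m ∸ j
-- equals the integer difference.
truncated-difference : ∀ m j → + (m ℕ.∸ j) * + countPerms m j ≡ (+ m - + j) * + countPerms m j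
truncated-difference m j with ℕP.≤-<-connex j m
... | inj₁ j≤m = cong (_* + countPerms m j) (sym (trans (ℤP.m-n≡m⊖n m j) (ℤP.⊖-≥ j≤m)))
... | inj₂ m<j rewrite countPerms-vanishes m j m<j = trans (ℤP.*-zeroʳ (+ (m ℕ.∸ j))) (sym (ℤP.*-zeroʳ (+ m - + j)))

f-previous : ∀ m j → f (+ m) (+ j - + 1) ≡ + previous (countPerms m) j
f-previous m ℕ.zero    = refl
f-previous m (ℕ.suc j) = refl

-- The first-order recurrence for f, valid for every integer J (both sides
-- vanish for negative J).
f-recurrence : ∀ m J → f (+ ℕ.suc m) J ≡ f (+ m) (J - + 1) + (J + + 1) * f (+ m) (J + + 1) + (+ m - J) * f (+ m) J
f-recurrence m (+ j) =
  begin
    + countPerms (ℕ.suc m) j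
  ≡⟨ cong +_ (countPerms-recurrence m j) ⟩
    + (previous (countPerms m) j ℕ.+ ℕ.suc j ℕ.* countPerms m (ℕ.suc j) ℕ.+ (m ℕ.∸ j) ℕ.* countPerms m j)
  ≡⟨ ℤP.pos-+ _ ((m ℕ.∸ j) ℕ.* countPerms m j) ⟩
    + (previous (countPerms m) j ℕ.+ ℕ.suc j ℕ.* countPerms m (ℕ.suc j)) + + ((m ℕ.∸ j) ℕ.* countPerms m j)
  ≡⟨ cong₂ _+_ (ℤP.pos-+ (previous (countPerms m) j) _) (ℤP.pos-* (m ℕ.∸ j) (countPerms m j)) ⟩
    + previous (countPerms m) j + + (ℕ.suc j ℕ.* countPerms m (ℕ.suc j)) + + (m ℕ.∸ j) * + countPerms m j
  ≡⟨ cong₂ (λ p q → p + q + + (m ℕ.∸ j) * + countPerms m j) (sym (f-previous m j)) gain-term ⟩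
    f (+ m) (+ j - + 1) + (+ j + + 1) * f (+ m) (+ j + + 1) + + (m ℕ.∸ j) * + countPerms m j
  ≡⟨ cong (λ t → f (+ m) (+ j - + 1) + (+ j + + 1) * f (+ m) (+ j + + 1) + t) (truncated-difference m j) ⟩
    f (+ m) (+ j - + 1) + (+ j + + 1) * f (+ m) (+ j + + 1) + (+ m - + j) * f (+ m) (+ j)
  ∎
  where
  open ≡-Reasoning
  gain-term : + (ℕ.suc j ℕ.* countPerms m (ℕ.suc j)) ≡ (+ j + + 1) * f (+ m) (+ j + + 1)
  gain-term = trans (ℤP.pos-* (ℕ.suc j) _) (cong (λ i → + i * + countPerms m i) (ℕP.+-comm 1 j))
f-recurrence m -[1+ ℕ.zero ] = sym (vanishing (f (+ m) (+ 0)) (+ m - -[1+ 0 ]))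
  where
  vanishing : ∀ a b → + 0 + + 0 * a + b * + 0 ≡ + 0
  vanishing = solve-∀
f-recurrence m -[1+ ℕ.suc n ] = sym (vanishing -[1+ n ] (+ m - -[1+ ℕ.suc n ]))
  where
  vanishing : ∀ a b → + 0 + a * + 0 + b * + 0 ≡ + 0
  vanishing = solve-∀

-- The recurrence with the shifted arguments J - 1 and J + 1 given in any form.
f-recurrence-at : ∀ m J {J₋ J₊} → J₋ ≡ J - + 1 → J₊ ≡ J + + 1 →
  f (+ ℕ.suc m) J ≡ f (+ m) J₋ + J₊ * f (+ m) J₊ + (+ m - J) * f (+ m) J
f-recurrence-at m J refl refl = f-recurrence m J

-- Eliminating the values at size I - 1 from one step at size I using two
-- steps at size I - 1 gives the second-order recurrence of the theorem.
second-order : ∀ (I J : ℤ) {x y z u p q r s : ℤ} →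
  x ≡ y + (J + + 1) * z + (I - + 1 - J) * u →
  y ≡ p + J * q + (I - + 2 - (J - + 1)) * r →
  u ≡ r + (J + + 1) * s + (I - + 2 - J) * q →
  x ≡ + 2 * (y - p) + p + (J + + 1) * (z - q) + (I - J - + 1) * q + (I - J - + 2) * (u - r) + (J + + 1) * s
second-order I J {z = z} {p = p} {q} {r} {s} refl refl refl = identity I J z p q r s
  where
  identity : ∀ I J z p q r s →
    let y = p + J * q + (I - + 2 - (J - + 1)) * r
        u = r + (J + + 1) * s + (I - + 2 - J) * q
    in y + (J + + 1) * z + (I - + 1 - J) * u
       ≡ + 2 * (y - p) + p + (J + + 1) * (z - q) + (I - J - + 1) * q + (I - J - + 2) * (u - r) + (J + + 1) * s
  identity = solve-∀

theorem2 : (i j : ℕ) → 3 ≤ i → j ≤ i Data.Nat.+ 1 →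
    f (+ i) (+ j) ≡
      + 2 * (f (+ i - + 1) (+ j - + 1) - f (+ i - + 2) (+ j - + 2))
      + f (+ i - + 2) (+ j - + 2)
      + (+ j + + 1) * (f (+ i - + 1) (+ j + + 1) - f (+ i - + 2) (+ j))
      + (+ i - + j - + 1) * f (+ i - + 2) (+ j)
      + (+ i - + j - + 2) * (f (+ i - + 1) (+ j) - f (+ i - + 2) (+ j - + 1))
      + (+ j + + 1) * f (+ i - + 2) (+ j + + 1)
theorem2 0 j () _
theorem2 1 j (ℕ.s≤s ()) _
theorem2 2 j (ℕ.s≤s (ℕ.s≤s ())) _
theorem2 i@(ℕ.suc (ℕ.suc (ℕ.suc n))) j _ _ =
  second-order (+ i) (+ j)
    (f-recurrence-at (ℕ.suc (ℕ.suc n)) (+ j) refl refl)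
    (f-recurrence-at (ℕ.suc n) (+ j - + 1) (two-steps (+ j)) (back-and-forth (+ j)))
    (f-recurrence-at (ℕ.suc n) (+ j) refl refl)
  where
  two-steps : ∀ J → J - + 2 ≡ J - + 1 - + 1
  two-steps = solve-∀
  back-and-forth : ∀ J → J ≡ J - + 1 + + 1
  back-and-forth = solve-∀
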